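{- Let $a,n\in\mathbb N$ with $n\ge 2$. For every $i$ with $2\le i\le n$, the degrees in (the underlying graph of) $J_n(a)$ satisfy $|d(v_i)-d(v_{i-1})|\le a$.
   Context: For $a\in\mathbb N$, the infinite Jaco graph $J_\infty(a)$ is the directed graph with vertex set $\{v_i:i\in\mathbb N\}$ in which every arc has the form $(v_i,v_j)$ with $i<j$, and for $i<j$, $(v_i,v_j)$ is an arc iff $(a+1)i-d^-(v_i)\ge j$, where $d^-(v_i)$ is the in-degree of $v_i$ (determined recursively). For $n\in\mathbb N$, the finite Jaco graph $J_n(a)$ is the subgraph of $J_\infty(a)$ induced on $\{v_1,\dots,v_n\}$. The degree $d(v)$ of a vertex of $J_n(a)$ is its in-degree plus out-degree in $J_n(a)$. -}

module Defs where

open import Data.Nat using (ℕ; zero; suc; _*_; _∸_; _≤_; _<_; _≤?_; _<?_; _+_)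
open import Data.Product using (_×_; _,_; proj₁; proj₂)
open import Data.List using (List; []; _∷_; _++_; [_]; map; filter; length; upTo)
open import Relation.Nullary using (Dec)
open import Relation.Nullary.Decidable using (_×-dec_)

-- Vertices v_i are indexed by i ∈ {1,2,...}.
-- inTable a k = [(1, d⁻(v_1)), …, (k, d⁻(v_k))], the in-degrees in J_∞(a),
-- computed by the recursive definition: d⁻(v_{k+1}) is the number of
-- h ∈ {1,…,k} with (a+1)h − d⁻(v_h) ≥ k+1.
inTable : ℕ → ℕ → List (ℕ × ℕ)
inTable a zero = []
inTable a (suc k) =
  let t = inTable a k in
  t ++ [ (suc k , length (filter (λ p → suc k ≤? suc a * proj₁ p ∸ proj₂ p) t)) ]

inDeg∞ : ℕ → ℕ → ℕ
inDeg∞ a i = length (filter (λ p → i ≤? suc a * proj₁ p ∸ proj₂ p) (inTable a (i ∸ 1)))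

Arc : ℕ → ℕ → ℕ → Set
Arc a i j = (i < j) × (j ≤ suc a * i ∸ inDeg∞ a i)

Arc? : ∀ a i j → Dec (Arc a i j)
Arc? a i j = (i <? j) ×-dec (j ≤? suc a * i ∸ inDeg∞ a i)

verts : ℕ → List ℕ
verts n = map suc (upTo n)

-- degree (in-degree + out-degree) of v_i in J_n(a), the subgraph of
-- J_∞(a) induced on {v_1,…,v_n}
deg : ℕ → ℕ → ℕ → ℕ
deg a n i = length (filter (λ h → Arc? a h i) (verts n))
          + length (filter (λ j → Arc? a i j) (verts n))

-- Write dₖ = d⁻(vₖ) and rₖ = (a+1)k − dₖ for the reach of vₖ, so the out-arcs
-- of vₖ go to v_{k+1}, …, v_{rₖ}.  Counting the h < k+2 whose reach is at least
-- k+2 shows d_{k+2} + eₖ = d_{k+1} + 1, where eₖ is the number of h ≤ k whose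
-- reach is exactly k+1.  Hence d grows by at most 1 per step, so r grows by at least
-- a ≥ 1 per step; r is then injective, eₖ ≤ 1, and d grows by 0 or 1 per step.
-- In Jₙ(a) the vertex vᵢ has in-degree dᵢ and out-degree min(rᵢ, n) − i, so
--   d(vᵢ) = min(a·i, dᵢ + n − i).
-- From i − 1 to i the first argument grows by exactly a and the second falls
-- by 0 or 1, and |min(x,y) − min(x′,y′)| ≤ max(|x − x′|, |y − y′|).
module Submission where

open import Defs
open import Data.Bool using (true; false)
open import Data.Nat using (ℕ; zero; suc; pred; _+_; _*_; _∸_; _⊓_; _≤_; _<_; _≤?_; _<?_; _≟_; ∣_-_∣; z≤n; s≤s; s≤s⁻¹)
open import Data.Nat.Properties
open import Algebra.Properties.CommutativeSemigroup +-commutativeSemigroup using (xy∙z≈xz∙y)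
open import Data.Product using (_×_; _,_)
open import Data.Sum using (inj₁; inj₂)
open import Data.List using (List; []; _∷_; _++_; [_]; map; filter; length; upTo)
open import Data.List.Properties using (length-++; filter-++; filter-accept; filter-reject; length-filter; length-map; length-upTo; map-++; upTo-∷ʳ)
open import Function using (_∘_)
open import Function.Definitions using (Injective)
open import Level using (Level)
open import Relation.Binary.Definitions using (tri<; tri≈; tri>)
open import Relation.Binary.PropositionalEquality using (_≡_; _≢_; refl; sym; trans; cong; cong₂; module ≡-Reasoning)
open import Relation.Nullary using (¬_; yes; no; does; contradiction)
open import Relation.Nullary.Decidable using (_×-dec_)
open import Relation.Unary using (Pred; Decidable)

private
  variable
    ℓ : Level
    k m n o : ℕ

∣-∣≤⇒≤+ : ∣ m - n ∣ ≤ k → m ≤ n + k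
∣-∣≤⇒≤+ {m} {n} le = ≤-trans (m≤n+∣m-n∣ m n) (+-monoʳ-≤ n le)

≤+⇒∣-∣≤ : m ≤ n + k → n ≤ m + k → ∣ m - n ∣ ≤ k
≤+⇒∣-∣≤ {m} {n} m≤n+k n≤m+k with ∣m-n∣≡[m∸n]∨[n∸m] m n
... | inj₁ eq = ≤-trans (≤-reflexive eq) (m≤n+o⇒m∸n≤o m n m≤n+k)
... | inj₂ eq = ≤-trans (≤-reflexive eq) (m≤n+o⇒m∸n≤o n m n≤m+k)

⊓≤⊓+ : ∀ m n o p → ∣ m - o ∣ ≤ k → ∣ n - p ∣ ≤ k → m ⊓ n ≤ o ⊓ p + k
⊓≤⊓+ {k} m n o p mo np = ≤-trans (⊓-mono-≤ (∣-∣≤⇒≤+ mo) (∣-∣≤⇒≤+ np)) (≤-reflexive (sym (+-distribʳ-⊓ k o p)))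

∣⊓-⊓∣≤ : ∀ m n o p → ∣ m - o ∣ ≤ k → ∣ n - p ∣ ≤ k → ∣ m ⊓ n - o ⊓ p ∣ ≤ k
∣⊓-⊓∣≤ m n o p mo np = ≤+⇒∣-∣≤ (⊓≤⊓+ m n o p mo np)
  (⊓≤⊓+ o p m n (≤-trans (≤-reflexive (∣-∣-comm o m)) mo) (≤-trans (≤-reflexive (∣-∣-comm p n)) np))

m+n≡o⇒∣m-o∣≡n : m + n ≡ o → ∣ m - o ∣ ≡ n
m+n≡o⇒∣m-o∣≡n {m} {n} refl = ∣m-m+n∣≡n m n

∣m*[1+n]-m*n∣≡m : ∀ m n → ∣ m * suc n - m * n ∣ ≡ m
∣m*[1+n]-m*n∣≡m m n = trans (∣-∣-comm (m * suc n) (m * n)) (m+n≡o⇒∣m-o∣≡n (trans (+-comm (m * n) m) (sym (*-suc m n))))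

<-step⇒<-mono : (f : ℕ → ℕ) → (∀ n → f n < f (suc n)) → m < n → f m < f n
<-step⇒<-mono {m} {suc n} f step m<1+n with m≤n⇒m<n∨m≡n (s≤s⁻¹ m<1+n)
... | inj₁ m<n = <-trans (<-step⇒<-mono f step m<n) (step n)
... | inj₂ refl = step n

<-step⇒injective : (f : ℕ → ℕ) → (∀ n → f n < f (suc n)) → Injective _≡_ _≡_ f
<-step⇒injective f step {m} {n} eq with <-cmp m n
... | tri< m<n _ _ = contradiction eq (<⇒≢ (<-step⇒<-mono f step m<n))
... | tri≈ _ m≡n _ = m≡n
... | tri> _ _ n<m = contradiction (sym eq) (<⇒≢ (<-step⇒<-mono f step n<m))

verts-suc : ∀ n → verts (suc n) ≡ verts n ++ [ suc n ]
verts-suc n = trans (cong (map suc) (sym (upTo-∷ʳ n))) (map-++ suc (upTo n) [ n ])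

length-filter-map : ∀ {A B : Set} {P : Pred B ℓ} (P? : Decidable P) (f : A → B) (xs : List A) →
  length (filter P? (map f xs)) ≡ length (filter (P? ∘ f) xs)
length-filter-map P? f [] = refl
length-filter-map P? f (x ∷ xs) with does (P? (f x))
... | true  = cong suc (length-filter-map P? f xs)
... | false = length-filter-map P? f xs

module _ {P : Pred ℕ ℓ} (P? : Decidable P) where

  count : ℕ → ℕ
  count n = length (filter P? (verts n))

  count-suc : count (suc n) ≡ count n + length (filter P? [ suc n ])
  count-suc {n} = begin
    length (filter P? (verts (suc n)))                  ≡⟨ cong (length ∘ filter P?) (verts-suc n) ⟩
    length (filter P? (verts n ++ [ suc n ]))           ≡⟨ cong length (filter-++ P? (verts n) [ suc n ]) ⟩
    length (filter P? (verts n) ++ filter P? [ suc n ]) ≡⟨ length-++ (filter P? (verts n)) ⟩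
    count n + length (filter P? [ suc n ])              ∎
    where open ≡-Reasoning

  count-yes : P (suc n) → count (suc n) ≡ suc (count n)
  count-yes {n} p = trans count-suc (trans (cong (λ xs → count n + length xs) (filter-accept P? p)) (+-comm (count n) 1))

  count-no : ¬ P (suc n) → count (suc n) ≡ count n
  count-no {n} ¬p = trans count-suc (trans (cong (λ xs → count n + length xs) (filter-reject P? ¬p)) (+-identityʳ (count n)))

  count≤ : ∀ n → count n ≤ n
  count≤ n = ≤-trans (length-filter P? (verts n)) (≤-reflexive (trans (length-map suc (upTo n)) (length-upTo n)))

  count-none : ∀ n → (∀ h → h ≤ n → ¬ P h) → count n ≡ 0
  count-none zero    _    = refl
  count-none (suc n) none = trans (count-no (none (suc n) ≤-refl)) (count-none n (λ h h≤n → none h (m≤n⇒m≤1+n h≤n)))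

count-below : {P : Pred ℕ ℓ} (P? : Decidable P) → ∀ k n → count (λ h → (h <? suc k) ×-dec P? h) n ≡ count P? (k ⊓ n)
count-below P? k zero rewrite ⊓-zeroʳ k = refl
count-below P? k (suc n) with n <? k
... | yes n<k with P? (suc n)
...   | yes p
  rewrite m≥n⇒m⊓n≡n n<k
        | count-yes (λ h → (h <? suc k) ×-dec P? h) (s≤s n<k , p)
        | count-yes P? p
  = cong suc (trans (count-below P? k n) (cong (count P?) (m≥n⇒m⊓n≡n (<⇒≤ n<k))))
...   | no ¬p
  rewrite m≥n⇒m⊓n≡n n<k
        | count-no (λ h → (h <? suc k) ×-dec P? h) (λ (_ , p) → ¬p p)
        | count-no P? ¬p
  = trans (count-below P? k n) (cong (count P?) (m≥n⇒m⊓n≡n (<⇒≤ n<k)))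
count-below P? k (suc n) | no n≮k
  rewrite m≤n⇒m⊓n≡m (m≤n⇒m≤1+n (≮⇒≥ n≮k))
        | count-no (λ h → (h <? suc k) ×-dec P? h) (λ (h<1+k , _) → n≮k (s≤s⁻¹ h<1+k))
  = trans (count-below P? k n) (cong (count P?) (m≤n⇒m⊓n≡m (≮⇒≥ n≮k)))

count-≟-≤1 : (f : ℕ → ℕ) → Injective _≡_ _≡_ f → ∀ c n → count (λ h → f h ≟ c) n ≤ 1
count-≟-≤1 f inj c zero = z≤n
count-≟-≤1 f inj c (suc n) with f (suc n) ≟ c
... | yes eq = ≤-reflexive (trans (count-yes (λ h → f h ≟ c) eq) (cong suc (count-none (λ h → f h ≟ c) n unhit)))
  where
  unhit : ∀ h → h ≤ n → f h ≢ c
  unhit h h≤n e = <⇒≢ (s≤s h≤n) (inj (trans e (sym eq)))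
... | no ne = ≤-trans (≤-reflexive (count-no (λ h → f h ≟ c) ne)) (count-≟-≤1 f inj c n)

count-≤-split : (f : ℕ → ℕ) → ∀ c n →
  count (λ h → c ≤? f h) n ≡ count (λ h → suc c ≤? f h) n + count (λ h → f h ≟ c) n
count-≤-split f c zero = refl
count-≤-split f c (suc n) with <-cmp (f (suc n)) c
... | tri< fn<c _ _
  rewrite count-no (λ h → c ≤? f h) (<⇒≱ fn<c)
        | count-no (λ h → suc c ≤? f h) (λ c<fn → <⇒≱ fn<c (<⇒≤ c<fn))
        | count-no (λ h → f h ≟ c) (<⇒≢ fn<c)
  = count-≤-split f c n
... | tri≈ _ fn≡c _
  rewrite count-yes (λ h → c ≤? f h) (≤-reflexive (sym fn≡c))
        | count-no (λ h → suc c ≤? f h) (λ c<fn → <⇒≢ c<fn (sym fn≡c))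
        | count-yes (λ h → f h ≟ c) fn≡c
  = trans (cong suc (count-≤-split f c n)) (sym (+-suc _ _))
... | tri> _ _ c<fn
  rewrite count-yes (λ h → c ≤? f h) (<⇒≤ c<fn)
        | count-yes (λ h → suc c ≤? f h) c<fn
        | count-no (λ h → f h ≟ c) (>⇒≢ c<fn)
  = cong suc (count-≤-split f c n)

count-interval : ∀ i x n → count (λ j → (i <? j) ×-dec (j ≤? x)) n ≡ x ⊓ n ∸ i
count-interval i x zero rewrite ⊓-zeroʳ x = sym (0∸n≡0 i)
count-interval i x (suc n) with n <? x
... | no n≮x
  rewrite m≤n⇒m⊓n≡m (m≤n⇒m≤1+n (≮⇒≥ n≮x))
        | count-no (λ j → (i <? j) ×-dec (j ≤? x)) (λ (_ , n<x) → n≮x n<x)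
  = trans (count-interval i x n) (cong (_∸ i) (m≤n⇒m⊓n≡m (≮⇒≥ n≮x)))
... | yes n<x with i ≤? n
...   | yes i≤n
  rewrite m≥n⇒m⊓n≡n n<x
        | count-yes (λ j → (i <? j) ×-dec (j ≤? x)) (s≤s i≤n , n<x)
        | +-∸-assoc 1 i≤n
  = cong suc (trans (count-interval i x n) (cong (_∸ i) (m≥n⇒m⊓n≡n (<⇒≤ n<x))))
...   | no i≰n
  rewrite m≥n⇒m⊓n≡n n<x
        | count-no (λ j → (i <? j) ×-dec (j ≤? x)) (λ (i<1+n , _) → i≰n (s≤s⁻¹ i<1+n))
        | m≤n⇒m∸n≡0 (≰⇒> i≰n)
  = trans (count-interval i x n) (trans (cong (_∸ i) (m≥n⇒m⊓n≡n (<⇒≤ n<x))) (m≤n⇒m∸n≡0 (<⇒≤ (≰⇒> i≰n))))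

module Jaco (a : ℕ) where

  reach : ℕ → ℕ
  reach h = suc a * h ∸ inDeg∞ a h

  inTable≡ : ∀ k → inTable a k ≡ map (λ h → h , inDeg∞ a h) (verts k)
  inTable≡ zero = refl
  inTable≡ (suc k) = begin
    inTable a k ++ [ entry (suc k) ]             ≡⟨ cong (_++ [ entry (suc k) ]) (inTable≡ k) ⟩
    map entry (verts k) ++ map entry [ suc k ]   ≡⟨ sym (map-++ entry (verts k) [ suc k ]) ⟩
    map entry (verts k ++ [ suc k ])             ≡⟨ cong (map entry) (sym (verts-suc k)) ⟩
    map entry (verts (suc k))                    ∎
    where
    open ≡-Reasoning
    entry : ℕ → ℕ × ℕ
    entry h = h , inDeg∞ a h

  inDeg∞-count : ∀ k → inDeg∞ a (suc k) ≡ count (λ h → suc k ≤? reach h) k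
  inDeg∞-count k = trans (cong (length ∘ filter _) (inTable≡ k)) (length-filter-map _ _ (verts k))

  inDeg∞≤pred : ∀ h → inDeg∞ a h ≤ pred h
  inDeg∞≤pred zero    = z≤n
  inDeg∞≤pred (suc k) = ≤-trans (≤-reflexive (inDeg∞-count k)) (count≤ _ k)

  reach+inDeg∞ : ∀ h → reach h + inDeg∞ a h ≡ suc a * h
  reach+inDeg∞ h = m∸n+n≡m (≤-trans (inDeg∞≤pred h) (≤-trans pred[n]≤n (m≤m+n h (a * h))))

  module _ (1≤a : 1 ≤ a) where

    suc<reach : ∀ k → suc k < reach (suc k)
    suc<reach k = +-cancelʳ-≤ k (suc (suc k)) (reach (suc k)) (begin
      suc (suc k) + k                     ≡⟨ sym (+-suc (suc k) k) ⟩
      suc k + suc k                       ≤⟨ +-monoʳ-≤ (suc k) (≤-trans (≤-reflexive (sym (*-identityˡ (suc k)))) (*-monoˡ-≤ (suc k) 1≤a)) ⟩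
      suc a * suc k                       ≡⟨ sym (reach+inDeg∞ (suc k)) ⟩
      reach (suc k) + inDeg∞ a (suc k)    ≤⟨ +-monoʳ-≤ (reach (suc k)) (inDeg∞≤pred (suc k)) ⟩
      reach (suc k) + k                   ∎)
      where open ≤-Reasoning

    endingAt : ℕ → ℕ
    endingAt k = count (λ h → reach h ≟ suc k) k

    inDeg∞-step : ∀ k → inDeg∞ a (suc (suc k)) + endingAt k ≡ suc (inDeg∞ a (suc k))
    inDeg∞-step k = begin
      inDeg∞ a (suc (suc k)) + endingAt k                          ≡⟨ cong (_+ endingAt k) (inDeg∞-count (suc k)) ⟩
      count (λ h → suc (suc k) ≤? reach h) (suc k) + endingAt k    ≡⟨ cong (_+ endingAt k) (count-yes (λ h → suc (suc k) ≤? reach h) (suc<reach k)) ⟩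
      suc (count (λ h → suc (suc k) ≤? reach h) k + endingAt k)    ≡⟨ cong suc (sym (count-≤-split reach (suc k) k)) ⟩
      suc (count (λ h → suc k ≤? reach h) k)                       ≡⟨ cong suc (sym (inDeg∞-count k)) ⟩
      suc (inDeg∞ a (suc k))                                       ∎
      where open ≡-Reasoning

    inDeg∞-suc≤ : ∀ h → inDeg∞ a (suc h) ≤ suc (inDeg∞ a h)
    inDeg∞-suc≤ zero    = z≤n
    inDeg∞-suc≤ (suc k) = ≤-trans (m≤m+n _ (endingAt k)) (≤-reflexive (inDeg∞-step k))

    reach-< : ∀ h → reach h < reach (suc h)
    reach-< h = +-cancelʳ-≤ (inDeg∞ a (suc h)) (suc (reach h)) (reach (suc h)) (begin
      suc (reach h) + inDeg∞ a (suc h)     ≤⟨ +-monoʳ-≤ (suc (reach h)) (inDeg∞-suc≤ h) ⟩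
      suc (reach h) + suc (inDeg∞ a h)     ≡⟨ cong suc (+-suc (reach h) (inDeg∞ a h)) ⟩
      2 + (reach h + inDeg∞ a h)           ≡⟨ cong (2 +_) (reach+inDeg∞ h) ⟩
      2 + suc a * h                        ≤⟨ +-monoˡ-≤ (suc a * h) (s≤s 1≤a) ⟩
      suc a + suc a * h                    ≡⟨ sym (*-suc (suc a) h) ⟩
      suc a * suc h                        ≡⟨ sym (reach+inDeg∞ (suc h)) ⟩
      reach (suc h) + inDeg∞ a (suc h)     ∎)
      where open ≤-Reasoning

    endingAt≤1 : ∀ k → endingAt k ≤ 1
    endingAt≤1 k = count-≟-≤1 reach (<-step⇒injective reach reach-<) (suc k) k

    deg≡min : ∀ n k → suc k ≤ n → deg a n (suc k) ≡ a * suc k ⊓ (inDeg∞ a (suc k) + n ∸ suc k)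
    deg≡min n k 1+k≤n = begin
      deg a n i                                 ≡⟨ cong₂ _+_ in-degree (count-interval i r n) ⟩
      d + (r ⊓ n ∸ i)                           ≡⟨ sym (+-∸-assoc d (⊓-glb (<⇒≤ (suc<reach k)) 1+k≤n)) ⟩
      d + r ⊓ n ∸ i                             ≡⟨ cong (_∸ i) (+-distribˡ-⊓ d r n) ⟩
      (d + r) ⊓ (d + n) ∸ i                     ≡⟨ cong (λ x → x ⊓ (d + n) ∸ i) (trans (+-comm d r) (reach+inDeg∞ i)) ⟩
      (i + a * i) ⊓ (d + n) ∸ i                 ≡⟨ mono-≤-distrib-⊓ (∸-monoˡ-≤ i) (i + a * i) (d + n) ⟩
      (i + a * i ∸ i) ⊓ (d + n ∸ i)             ≡⟨ cong (_⊓ (d + n ∸ i)) (m+n∸m≡n i (a * i)) ⟩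
      a * i ⊓ (d + n ∸ i)                       ∎
      where
      open ≡-Reasoning
      i d r : ℕ
      i = suc k
      d = inDeg∞ a i
      r = reach i
      in-degree : count (λ h → Arc? a h i) n ≡ d
      in-degree = begin
        count (λ h → Arc? a h i) n            ≡⟨ count-below (λ h → i ≤? reach h) k n ⟩
        count (λ h → i ≤? reach h) (k ⊓ n)    ≡⟨ cong (count (λ h → i ≤? reach h)) (m≤n⇒m⊓n≡m (<⇒≤ 1+k≤n)) ⟩
        count (λ h → i ≤? reach h) k          ≡⟨ sym (inDeg∞-count k) ⟩
        d                                     ∎

lemma2p3 : (a n : ℕ) → 1 ≤ a → 2 ≤ n → (i : ℕ) → 2 ≤ i → i ≤ n →
    ∣ deg a n i - deg a n (i ∸ 1) ∣ ≤ a
lemma2p3 _ _ _ _ 1 (s≤s ()) _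
lemma2p3 a n 1≤a _ (suc (suc k)) _ i≤n = begin
  ∣ deg a n (suc (suc k)) - deg a n (suc k) ∣
    ≡⟨ cong₂ ∣_-_∣ (deg≡min 1≤a n (suc k) i≤n) (deg≡min 1≤a n k (<⇒≤ i≤n)) ⟩
  ∣ a * suc (suc k) ⊓ (d′ + n ∸ suc (suc k)) - a * suc k ⊓ (d + n ∸ suc k) ∣
    ≤⟨ ∣⊓-⊓∣≤ (a * suc (suc k)) _ (a * suc k) _ (≤-reflexive (∣m*[1+n]-m*n∣≡m a (suc k))) tail-step ⟩
  a ∎
  where
  open Jaco a
  open ≤-Reasoning
  d d′ e : ℕ
  d  = inDeg∞ a (suc k)
  d′ = inDeg∞ a (suc (suc k))
  e  = endingAt 1≤a k
  tail-shift : d′ + n ∸ suc (suc k) + e ≡ d + n ∸ suc k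
  tail-shift = begin-equality
    d′ + n ∸ suc (suc k) + e    ≡⟨ sym (+-∸-comm e (≤-trans i≤n (m≤n+m n d′))) ⟩
    d′ + n + e ∸ suc (suc k)    ≡⟨ cong (_∸ suc (suc k)) (xy∙z≈xz∙y d′ n e) ⟩
    d′ + e + n ∸ suc (suc k)    ≡⟨ cong (λ x → x + n ∸ suc (suc k)) (inDeg∞-step 1≤a k) ⟩
    suc d + n ∸ suc (suc k)     ∎
  tail-step : ∣ d′ + n ∸ suc (suc k) - (d + n ∸ suc k) ∣ ≤ a
  tail-step = begin
    ∣ d′ + n ∸ suc (suc k) - (d + n ∸ suc k) ∣    ≡⟨ m+n≡o⇒∣m-o∣≡n tail-shift ⟩
    e                                             ≤⟨ endingAt≤1 1≤a k ⟩
    1                                             ≤⟨ 1≤a ⟩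
    a                                             ∎
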